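{- Let $T$ be a tournament with vertex set $V$. Then $\gamma_{os}(T)=1$ if and only if there exists $u\in V$ with $d^-(u)=0$.
   Context: A tournament is an orientation of a complete graph; $d^-(u)$ is the number of in-neighbors of $u$. For a digraph $D=(V,A)$ with underlying graph $G$ (vertices $u,v$ adjacent iff $uv\in A$ or $vu\in A$), $S\subseteq V$ is dominating in $G$ if every vertex outside $S$ has a neighbor in $S$. $S$ is an out-secure dominating set (OSDS) of $D$ if $S$ is dominating in $G$ and for every $v\in V\setminus S$ there is an in-neighbor $u\in S$ of $v$ such that $(S\setminus\{u\})\cup\{v\}$ is dominating in $G$; $\gamma_{os}(D)$ is the minimum size of an OSDS. -}

module Defs where

open import Data.Nat using (ℕ)
open import Data.Bool using (Bool; true; false; T)
open import Data.Fin using (Fin)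
open import Data.Fin.Subset using (Subset; _∈_; _∉_; ∣_∣; ⁅_⁆; _∪_; _-_)
open import Data.List using (List; filter; length; allFin)
open import Data.Product using (_×_; ∃-syntax)
open import Data.Sum using (_⊎_)
open import Data.Empty using (⊥)
open import Data.Bool.Properties using (T?)
open import Relation.Binary.PropositionalEquality using (_≡_; _≢_)

-- A digraph D = (V, A) with V = Fin n, given by its arc relation:
-- D u v ≡ true  iff  uv ∈ A.
Digraph : ℕ → Set
Digraph n = Fin n → Fin n → Bool

record IsTournament {n : ℕ} (D : Digraph n) : Set where
  field
    irrefl  : ∀ u → D u u ≡ false
    total   : ∀ u v → u ≢ v → T (D u v) ⊎ T (D v u)
    asym    : ∀ u v → T (D u v) → T (D v u) → ⊥

indeg : ∀ {n} → Digraph n → Fin n → ℕ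
indeg {n} D u = length (filter (λ v → T? (D v u)) (allFin n))

Adj : ∀ {n} → Digraph n → Fin n → Fin n → Set
Adj D u v = T (D u v) ⊎ T (D v u)

Dominating : ∀ {n} → Digraph n → Subset n → Set
Dominating {n} D S = ∀ (v : Fin n) → v ∉ S → ∃[ w ] (w ∈ S × Adj D w v)

IsOSDS : ∀ {n} → Digraph n → Subset n → Set
IsOSDS {n} D S =
  Dominating D S ×
  (∀ (v : Fin n) → v ∉ S →
     ∃[ u ] (u ∈ S × T (D u v) × Dominating D ((S - u) ∪ ⁅ v ⁆)))

γos≡ : ∀ {n} → Digraph n → ℕ → Set
γos≡ {n} D k =
  (∃[ S ] (IsOSDS D S × ∣ S ∣ ≡ k)) ×
  (∀ (S : Subset n) → IsOSDS D S → k Data.Nat.≤ ∣ S ∣)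

-- A source u (in-degree 0) beats every other vertex, so {u} dominates, and after
-- swapping u for any v the set {v} still dominates because any single vertex of a
-- tournament is adjacent to all others.  Conversely, if {u} is an out-secure
-- dominating set, every v ≠ u must have u as an in-neighbour, so by asymmetry no
-- arc enters u.
module Submission where

open import Defs
open import Data.Nat using (ℕ; _≤_; _<_; z≤n)
import Data.Nat.Properties as ℕ
open import Data.Fin using (Fin)
open import Data.Fin.Properties using (_≟_)
open import Data.Fin.Subset using (Subset; _∈_; _∉_; ∣_∣; ⁅_⁆; _∪_; _-_; Nonempty)
open import Data.Fin.Subset.Properties
  using (_∈?_; nonempty?; Empty-unique; ∣⊥∣≡0; x∈⁅x⁆; x∉⁅y⁆⇒x≢y; ∣⁅x⁆∣≡1;
         x∈p⇒∣p-x∣<∣p∣; x∈p∧x≢y⇒x∈p-y; x∈p∪q⁺)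
open import Data.Bool using (T)
open import Data.Bool.Properties using (T?)
open import Data.List using (length; allFin)
open import Data.List.Properties using (filter-none)
open import Data.List.Relation.Unary.All as All using ()
open import Data.List.Membership.Propositional.Properties using (∈-allFin; ∈-filter⁺; ∈-length)
open import Data.Product using (∃-syntax; _×_; _,_)
open import Data.Sum using (inj₁; inj₂)
open import Function.Bundles using (_⇔_; mk⇔; module Equivalence)
open import Relation.Nullary using (¬_; Dec; yes; no; contradiction)
open import Relation.Binary.PropositionalEquality using (_≡_; _≢_; sym; trans; cong; subst)

x∈p⇒0<∣p∣ : ∀ {n} {p : Subset n} {x} → x ∈ p → 0 < ∣ p ∣
x∈p⇒0<∣p∣ x∈p = ℕ.≤-<-trans z≤n (x∈p⇒∣p-x∣<∣p∣ x∈p)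

∣p∣≢0⇒Nonempty : ∀ {n} {p : Subset n} → ∣ p ∣ ≢ 0 → Nonempty p
∣p∣≢0⇒Nonempty {n} {p} ∣p∣≢0 with nonempty? p
... | yes ne = ne
... | no ¬ne = contradiction (trans (cong ∣_∣ (Empty-unique ¬ne)) (∣⊥∣≡0 n)) ∣p∣≢0

∣p∣≡1⇒x∈p⇒y∈p⇒x≡y : ∀ {n} {p : Subset n} {x y} → ∣ p ∣ ≡ 1 → x ∈ p → y ∈ p → x ≡ y
∣p∣≡1⇒x∈p⇒y∈p⇒x≡y {p = p} {x} {y} ∣p∣≡1 x∈p y∈p with x ≟ y
... | yes x≡y = x≡y
... | no x≢y = contradiction (x∈p⇒0<∣p∣ y∈p-x) (ℕ.≤⇒≯ ∣p-x∣≤0)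
  where
  y∈p-x : y ∈ p - x
  y∈p-x = x∈p∧x≢y⇒x∈p-y y∈p (λ y≡x → x≢y (sym y≡x))
  ∣p-x∣≤0 : ∣ p - x ∣ ≤ 0
  ∣p-x∣≤0 = ℕ.≤-pred (subst (∣ p - x ∣ <_) ∣p∣≡1 (x∈p⇒∣p-x∣<∣p∣ x∈p))

IsSource : ∀ {n} → Digraph n → Fin n → Set
IsSource D u = ∀ v → ¬ T (D v u)

indeg≡0⇔IsSource : ∀ {n} (D : Digraph n) u → indeg D u ≡ 0 ⇔ IsSource D u
indeg≡0⇔IsSource {n} D u = mk⇔
  (λ indeg≡0 v vu → ℕ.<⇒≢ (∈-length (∈-filter⁺ inArc? (∈-allFin v) vu)) (sym indeg≡0))
  (λ source → cong length (filter-none inArc? {allFin n} (All.tabulate (λ {v} _ → source v))))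
  where
  inArc? : ∀ v → Dec (T (D v u))
  inArc? v = T? (D v u)

Dominating⇒0<∣S∣ : ∀ {n} {D : Digraph n} {S} → Dominating D S → Fin n → 0 < ∣ S ∣
Dominating⇒0<∣S∣ {S = S} dom v with v ∈? S
... | yes v∈S = x∈p⇒0<∣p∣ v∈S
... | no v∉S with dom v v∉S
...   | _ , w∈S , _ = x∈p⇒0<∣p∣ w∈S

module Tournament {n} {D : Digraph n} (tournament : IsTournament D) where
  open IsTournament tournament

  ∈⇒Dominating : ∀ {S x} → x ∈ S → Dominating D S
  ∈⇒Dominating {S} {x} x∈S v v∉S = x , x∈S , total x v (λ x≡v → v∉S (subst (_∈ S) x≡v x∈S))

  IsSource⇒arc : ∀ {u v} → IsSource D u → v ≢ u → T (D u v)
  IsSource⇒arc {u} {v} source v≢u with total u v (λ u≡v → v≢u (sym u≡v))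
  ... | inj₁ uv = uv
  ... | inj₂ vu = contradiction vu (source v)

  IsSource⇒⁅⁆-IsOSDS : ∀ {u} → IsSource D u → IsOSDS D ⁅ u ⁆
  IsSource⇒⁅⁆-IsOSDS {u} source = ∈⇒Dominating (x∈⁅x⁆ u) , secure
    where
    secure : ∀ v → v ∉ ⁅ u ⁆ → ∃[ w ] (w ∈ ⁅ u ⁆ × T (D w v) × Dominating D ((⁅ u ⁆ - w) ∪ ⁅ v ⁆))
    secure v v∉⁅u⁆ = u , x∈⁅x⁆ u , IsSource⇒arc source (x∉⁅y⁆⇒x≢y v∉⁅u⁆)
                   , ∈⇒Dominating (x∈p∪q⁺ (inj₂ (x∈⁅x⁆ v)))

  IsOSDS∧∣S∣≡1⇒IsSource : ∀ {S u} → IsOSDS D S → ∣ S ∣ ≡ 1 → u ∈ S → IsSource D u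
  IsOSDS∧∣S∣≡1⇒IsSource {S} {u} (_ , secure) ∣S∣≡1 u∈S v vu with v ∈? S
  ... | yes v∈S = subst T (irrefl u) (subst (λ w → T (D w u)) (∣p∣≡1⇒x∈p⇒y∈p⇒x≡y ∣S∣≡1 v∈S u∈S) vu)
  ... | no v∉S with secure v v∉S
  ...   | w , w∈S , wv , _ = asym v u vu (subst (λ w → T (D w v)) (∣p∣≡1⇒x∈p⇒y∈p⇒x≡y ∣S∣≡1 w∈S u∈S) wv)

proposition3p13 : ∀ {n : ℕ} (T : Digraph n) → IsTournament T →
    (γos≡ T 1 ⇔ (∃[ u ] (indeg T u ≡ 0)))
proposition3p13 D tournament = mk⇔ source-of-γos≡1 γos≡1-of-source
  where
  open Tournament tournament

  source-of-γos≡1 : γos≡ D 1 → ∃[ u ] (indeg D u ≡ 0)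
  source-of-γos≡1 ((S , osds , ∣S∣≡1) , _) with ∣p∣≢0⇒Nonempty (subst (_≢ 0) (sym ∣S∣≡1) ℕ.1+n≢0)
  ... | u , u∈S = u , Equivalence.from (indeg≡0⇔IsSource D u) (IsOSDS∧∣S∣≡1⇒IsSource osds ∣S∣≡1 u∈S)

  γos≡1-of-source : ∃[ u ] (indeg D u ≡ 0) → γos≡ D 1
  γos≡1-of-source (u , indeg≡0) =
    (⁅ u ⁆ , IsSource⇒⁅⁆-IsOSDS (Equivalence.to (indeg≡0⇔IsSource D u) indeg≡0) , ∣⁅x⁆∣≡1 u)
    , λ _ (dom , _) → Dominating⇒0<∣S∣ dom u
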